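{- Let $T$ be a tableau of shape $\beta/\alpha$ with entries from $[k]$. Then its stable complement $T^S$ is a stable tableau with stable shape $(\infty^k,\alpha)/\beta$ and entries from $[k]$. Similarly, if $T$ is a stable tableau with entries from $[k]$, then $T^S$ is (after removing the common initial parts equal to $\infty$) an ordinary tableau with entries from $[k]$. In either case $T^{SS}=T$, identifying tableaux that differ only by a vertical shift.
   Context: A shape is a finite weakly decreasing sequence of integers; a stable shape is a finite weakly decreasing sequence of integers and the symbols $\infty$ and $\bar\infty$, where $\bar\infty<n<\infty$ for every integer $n$; stable shapes are regarded as having arbitrarily many trailing $\bar\infty$'s and are ordered componentwise. $(\infty^i,\gamma)$ denotes $\gamma$ with $i$ initial parts $\infty$ prepended. An ordinary horizontal strip $\beta/\alpha$ satisfies $\beta_i\geq\alpha_i\geq\beta_{i+1}$ for all $i$; a tableau with entries from $[k]$ is a chain $\beta^0\subseteq\cdots\subseteq\beta^k$ of shapes with horizontal-strip differences. A stable horizontal strip is a pair of stable shapes $\alpha\subseteq\beta$ such that, if $\alpha_m$ is the first finite part of $\alpha$ and $\beta_n$ the last finite part of $\beta$, then $\alpha_{m-1}=\infty=\beta_m>\alpha_m\geq\beta_{m+1}\geq\alpha_{m+1}\geq\cdots\geq\alpha_{n-1}\geq\beta_n>\alpha_n=\bar\infty=\beta_{n+1}$. A stable tableau with entries from $[k]$ is a chain $\beta^0\subseteq\cdots\subseteq\beta^k$ of stable shapes with each $\beta^i/\beta^{i-1}$ a stable horizontal strip. The stable complement of a (stable or ordinary) tableau $T:\beta^0\subseteq\cdots\subseteq\beta^k$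 is the chain $T^S:\beta^k\subseteq(\infty,\beta^{k-1})\subseteq(\infty^2,\beta^{k-2})\subseteq\cdots\subseteq(\infty^k,\beta^0)$. Tableaux differing only by a vertical shift (e.g. removing or prepending the same number of $\infty$ parts in each shape) are identified. -}

module Defs where

open import Data.Nat as ℕ using (ℕ; zero; suc)
open import Data.Integer as ℤ using (ℤ)
open import Data.Fin using (Fin; toℕ; inject₁; opposite) renaming (suc to fsuc)
open import Data.Vec using (Vec; []; _∷_; lookup)
open import Data.Product using (Σ; ∃; ∃-syntax; _×_)
open import Relation.Binary.PropositionalEquality using (_≡_)
open import Relation.Nullary using (¬_)

data Ext : Set where
  ∞̄  : Ext
  fin : ℤ → Ext
  ∞   : Ext

infix 4 _≤ᴱ_ _<ᴱ_

data _≤ᴱ_ : Ext → Ext → Set where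
  ∞̄≤      : ∀ {x} → ∞̄ ≤ᴱ x
  fin≤fin : ∀ {a b} → a ℤ.≤ b → fin a ≤ᴱ fin b
  ≤∞      : ∀ {x} → x ≤ᴱ ∞

data _<ᴱ_ : Ext → Ext → Set where
  ∞̄<fin   : ∀ {a} → ∞̄ <ᴱ fin a
  ∞̄<∞     : ∞̄ <ᴱ ∞
  fin<fin : ∀ {a b} → a ℤ.< b → fin a <ᴱ fin b
  fin<∞   : ∀ {a} → fin a <ᴱ ∞

IsFinite : Ext → Set
IsFinite x = ∃[ a ] x ≡ fin a

-- Stable shapes: sequences indexed by ℕ (index 0 = first part), weakly
-- decreasing, and eventually ∞̄ (the "arbitrarily many trailing ∞̄").

StableSeq : Set
StableSeq = ℕ → Ext

IsStableShape : StableSeq → Set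
IsStableShape s = (∀ i → s (suc i) ≤ᴱ s i) × (∃[ L ] (∀ i → L ℕ.≤ i → s i ≡ ∞̄))

_⊆ˢ_ : StableSeq → StableSeq → Set
α ⊆ˢ β = ∀ i → α i ≤ᴱ β i

FirstFinite : StableSeq → ℕ → Set
FirstFinite α m = IsFinite (α m) × (∀ i → i ℕ.< m → ¬ IsFinite (α i))

LastFinite : StableSeq → ℕ → Set
LastFinite β n = IsFinite (β n) × (∀ i → n ℕ.< i → ¬ IsFinite (β i))

-- β/α is a stable horizontal strip:
-- α_{m-1} = ∞ = β_m > α_m ≥ β_{m+1} ≥ α_{m+1} ≥ ⋯ ≥ α_{n-1} ≥ β_n > α_n = ∞̄ = β_{n+1}
IsStableHStrip : StableSeq → StableSeq → Set
IsStableHStrip α β =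
  α ⊆ˢ β ×
  Σ ℕ λ m → Σ ℕ λ n →
    FirstFinite α m × LastFinite β n ×
    (∀ i → suc i ≡ m → α i ≡ ∞) ×            -- α_{m-1} = ∞ (when m-1 exists)
    β m ≡ ∞ ×
    α m <ᴱ β m ×
    (∀ i → m ℕ.≤ i → i ℕ.< n → β (suc i) ≤ᴱ α i) ×
    (∀ i → m ℕ.< i → i ℕ.< n → α i ≤ᴱ β i) ×
    α n <ᴱ β n ×
    α n ≡ ∞̄ ×
    β (suc n) ≡ ∞̄

StableChain : ℕ → Set
StableChain k = Fin (suc k) → StableSeq

IsStableTableau : (k : ℕ) → StableChain k → Set
IsStableTableau k S =
  (∀ j → IsStableShape (S j)) ×
  (∀ (i : Fin k) → IsStableHStrip (S (inject₁ i)) (S (fsuc i)))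

IsShape : {N : ℕ} → Vec ℤ N → Set
IsShape v = ∀ i j → toℕ j ≡ suc (toℕ i) → lookup v j ℤ.≤ lookup v i

IsHStrip : {N : ℕ} → Vec ℤ N → Vec ℤ N → Set
IsHStrip α β =
  (∀ i → lookup α i ℤ.≤ lookup β i) ×
  (∀ i j → toℕ j ≡ suc (toℕ i) → lookup β j ℤ.≤ lookup α i)

IsTableau : (k N : ℕ) → (Fin (suc k) → Vec ℤ N) → Set
IsTableau k N T =
  (∀ j → IsShape (T j)) ×
  (∀ (i : Fin k) → IsHStrip (T (inject₁ i)) (T (fsuc i)))

embed : {N : ℕ} → Vec ℤ N → StableSeq
embed []       _       = ∞̄
embed (x ∷ v)  zero    = fin x
embed (x ∷ v)  (suc i) = embed v i

embedT : {k N : ℕ} → (Fin (suc k) → Vec ℤ N) → StableChain k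
embedT T j = embed (T j)

cons : Ext → StableSeq → StableSeq
cons x s zero    = x
cons x s (suc i) = s i

prepend : ℕ → StableSeq → StableSeq
prepend zero    s = s
prepend (suc c) s = cons ∞ (prepend c s)

-- Tᔆ : βᵏ ⊆ (∞,βᵏ⁻¹) ⊆ ⋯ ⊆ (∞ᵏ,β⁰); opposite j = k - j
complement : {k : ℕ} → StableChain k → StableChain k
complement S j = prepend (toℕ j) (S (opposite j))

_≗ˢ_ : StableSeq → StableSeq → Set
s ≗ˢ t = ∀ i → s i ≡ t i

ShiftEq : {k : ℕ} → StableChain k → StableChain k → Set
ShiftEq A B = Σ ℕ λ c → Σ ℕ λ d → ∀ j → prepend c (A j) ≗ˢ prepend d (B j)

{-# OPTIONS --safe #-}
-- Every shape, ordinary or stable, is (∞^c, v) for an integer vector v.  The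
-- complement reverses a chain and gives its j-th member j extra ∞'s, so the
-- ordinary strip condition β_i ≥ α_i ≥ β_{i+1} for consecutive vectors becomes,
-- after the relative shift by one place, the stable strip condition between
-- (∞^c, β) and (∞^(c+1), α).  Conversely, the end conditions of a stable strip
-- between (∞^a, v) and (∞^b, w) force b = a + 1 and |w| = |v|, so a stable
-- tableau is a chain of equally long vectors shifted one place per step.  Applying
-- the complement twice prepends k ∞'s to every shape.
module Submission where

open import Defs
open import Data.Nat using (ℕ; zero; suc; _+_; _≤_; _<_; z≤n; s≤s; s≤s⁻¹)
open import Data.Nat.Properties
  using (≤-refl; ≤-reflexive; ≤-trans; ≤-antisym; <-≤-trans; ≮⇒≥; <⇒≱; +-suc; +-assoc; +-cancelˡ-≡; m≤m+n; +-monoʳ-<)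
open import Data.Integer using (ℤ)
import Data.Integer as ℤ
open import Data.Fin using (Fin; fromℕ; zero; toℕ; inject₁; opposite) renaming (suc to fsuc)
open import Data.Fin.Properties using (toℕ-inject₁; toℕ-fromℕ; toℕ<n; opposite-involutive)
open import Data.Fin.Induction using (<-weakInduction)
open import Data.Vec using (Vec; []; _∷_; lookup)
open import Data.Product using (Σ; _×_; _,_; proj₁; proj₂)
open import Data.Empty using (⊥; ⊥-elim)
open import Function using (_∘_)
open import Relation.Binary.PropositionalEquality
  using (_≡_; _≢_; refl; sym; trans; cong; cong₂; subst; subst₂; module ≡-Reasoning)

∞≰fin : ∀ {x} → ∞ ≤ᴱ fin x → ⊥
∞≰fin ()

≤∞̄⇒≡∞̄ : ∀ {x} → x ≤ᴱ ∞̄ → x ≡ ∞̄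
≤∞̄⇒≡∞̄ ∞̄≤ = refl

fin≤fin⁻¹ : ∀ {x y} → fin x ≤ᴱ fin y → x ℤ.≤ y
fin≤fin⁻¹ (fin≤fin x≤y) = x≤y

Antitone : StableSeq → Set
Antitone s = ∀ i → s (suc i) ≤ᴱ s i

prepend-+ : ∀ c s q → prepend c s (c + q) ≡ s q
prepend-+ zero    s q = refl
prepend-+ (suc c) s q = prepend-+ c s q

prepend-head : ∀ c s → prepend c s c ≡ s 0
prepend-head zero    s = refl
prepend-head (suc c) s = prepend-head c s

prepend-< : ∀ c s {p} → p < c → prepend c s p ≡ ∞
prepend-< (suc c) s {zero}  _         = refl
prepend-< (suc c) s {suc p} (s≤s p<c) = prepend-< c s p<c

prepend-mono : ∀ c {s t} → s ⊆ˢ t → prepend c s ⊆ˢ prepend c t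
prepend-mono zero    s⊆t p       = s⊆t p
prepend-mono (suc c) s⊆t zero    = ≤∞
prepend-mono (suc c) s⊆t (suc p) = prepend-mono c s⊆t p

prepend-antitone : ∀ c {s} → Antitone s → Antitone (prepend c s)
prepend-antitone zero    anti p       = anti p
prepend-antitone (suc c) anti zero    = ≤∞
prepend-antitone (suc c) anti (suc p) = prepend-antitone c anti p

prepend-⊆-suc : ∀ c {s t} → s ⊆ˢ cons ∞ t → prepend c s ⊆ˢ prepend (suc c) t
prepend-⊆-suc zero    s⊆t p       = s⊆t p
prepend-⊆-suc (suc c) s⊆t zero    = ≤∞
prepend-⊆-suc (suc c) s⊆t (suc p) = prepend-⊆-suc c s⊆t p

prepend-cong : ∀ c {s t} → s ≗ˢ t → prepend c s ≗ˢ prepend c t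
prepend-cong zero    s≗t p       = s≗t p
prepend-cong (suc c) s≗t zero    = refl
prepend-cong (suc c) s≗t (suc p) = prepend-cong c s≗t p

prepend-prepend : ∀ c d s → prepend c (prepend d s) ≗ˢ prepend (c + d) s
prepend-prepend zero    d s i       = refl
prepend-prepend (suc c) d s zero    = refl
prepend-prepend (suc c) d s (suc i) = prepend-prepend c d s i

embed-interlace : ∀ {N} (A B : Vec ℤ N) →
  (∀ i j → toℕ j ≡ suc (toℕ i) → lookup A j ℤ.≤ lookup B i) →
  ∀ p → embed A (suc p) ≤ᴱ embed B p
embed-interlace []            []      _  p       = ∞̄≤
embed-interlace (a ∷ [])      (b ∷ B) _  zero    = ∞̄≤
embed-interlace (a ∷ a′ ∷ A)  (b ∷ B) le zero    = fin≤fin (le zero (fsuc zero) refl)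
embed-interlace (a ∷ A)       (b ∷ B) le (suc p) =
  embed-interlace A B (λ i j e → le (fsuc i) (fsuc j) (cong suc e)) p

embed-mono : ∀ {N} (A B : Vec ℤ N) → (∀ i → lookup A i ℤ.≤ lookup B i) → embed A ⊆ˢ embed B
embed-mono []      []      _  p       = ∞̄≤
embed-mono (a ∷ A) (b ∷ B) le zero    = fin≤fin (le zero)
embed-mono (a ∷ A) (b ∷ B) le (suc p) = embed-mono A B (le ∘ fsuc) p

embed-lookup : ∀ {N} (v : Vec ℤ N) (f : Fin N) → embed v (toℕ f) ≡ fin (lookup v f)
embed-lookup (x ∷ v) zero     = refl
embed-lookup (x ∷ v) (fsuc f) = embed-lookup v f

embed-last-finite : ∀ {N} (v : Vec ℤ (suc N)) → IsFinite (embed v N)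
embed-last-finite (x ∷ [])    = x , refl
embed-last-finite (x ∷ y ∷ v) = embed-last-finite (y ∷ v)

embed-≥⇒∞̄ : ∀ {N} (v : Vec ℤ N) {q} → N ≤ q → embed v q ≡ ∞̄
embed-≥⇒∞̄ []      _         = refl
embed-≥⇒∞̄ (x ∷ v) (s≤s N≤q) = embed-≥⇒∞̄ v N≤q

embed≢∞ : ∀ {N} (v : Vec ℤ N) p → embed v p ≡ ∞ → ⊥
embed≢∞ []      p       ()
embed≢∞ (x ∷ v) zero    ()
embed≢∞ (x ∷ v) (suc p) e = embed≢∞ v p e

embed-finite⇒< : ∀ {N} (v : Vec ℤ N) p → IsFinite (embed v p) → p < N
embed-finite⇒< []      p       (_ , ())
embed-finite⇒< (x ∷ v) zero    _     = s≤s z≤n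
embed-finite⇒< (x ∷ v) (suc p) p-fin = s≤s (embed-finite⇒< v p p-fin)

embed-∞̄⇒≥ : ∀ {N} (v : Vec ℤ N) p → embed v p ≡ ∞̄ → N ≤ p
embed-∞̄⇒≥ []      p       _ = z≤n
embed-∞̄⇒≥ (x ∷ v) zero    ()
embed-∞̄⇒≥ (x ∷ v) (suc p) e = s≤s (embed-∞̄⇒≥ v p e)

padded : ∀ {N} → ℕ → Vec ℤ N → StableSeq
padded c v = prepend c (embed v)

padded-∞⇒< : ∀ {N} c (v : Vec ℤ N) p → padded c v p ≡ ∞ → p < c
padded-∞⇒< zero    v p       e = ⊥-elim (embed≢∞ v p e)
padded-∞⇒< (suc c) v zero    e = s≤s z≤n
padded-∞⇒< (suc c) v (suc p) e = s≤s (padded-∞⇒< c v p e)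

padded-finite⇒∈ : ∀ {N} c (v : Vec ℤ N) p → IsFinite (padded c v p) → c ≤ p × p < c + N
padded-finite⇒∈ zero    v p       p-fin   = z≤n , embed-finite⇒< v p p-fin
padded-finite⇒∈ (suc c) v zero    (_ , ())
padded-finite⇒∈ (suc c) v (suc p) p-fin   =
  let c≤p , p<c+N = padded-finite⇒∈ c v p p-fin in s≤s c≤p , s≤s p<c+N

padded-∞̄⇒≥ : ∀ {N} c (v : Vec ℤ N) p → padded c v p ≡ ∞̄ → c + N ≤ p
padded-∞̄⇒≥ zero    v p       e = embed-∞̄⇒≥ v p e
padded-∞̄⇒≥ (suc c) v zero    ()
padded-∞̄⇒≥ (suc c) v (suc p) e = s≤s (padded-∞̄⇒≥ c v p e)

padded-≥⇒∞̄ : ∀ {N} c (v : Vec ℤ N) {p} → c + N ≤ p → padded c v p ≡ ∞̄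
padded-≥⇒∞̄ zero    v         c+N≤p       = embed-≥⇒∞̄ v c+N≤p
padded-≥⇒∞̄ (suc c) v {suc p} (s≤s c+N≤p) = padded-≥⇒∞̄ c v c+N≤p

padded-lookup : ∀ {N} c (v : Vec ℤ N) f → padded c v (c + toℕ f) ≡ fin (lookup v f)
padded-lookup c v f = trans (prepend-+ c (embed v) (toℕ f)) (embed-lookup v f)

padded-lookup-next : ∀ {N} c (v : Vec ℤ N) {i j : Fin N} → toℕ j ≡ suc (toℕ i) →
  padded c v (suc (c + toℕ i)) ≡ fin (lookup v j)
padded-lookup-next c v {i} {j} j≡1+i = begin
  padded c v (suc (c + toℕ i)) ≡⟨ cong (padded c v) (sym (+-suc c (toℕ i))) ⟩
  padded c v (c + suc (toℕ i)) ≡⟨ cong (λ q → padded c v (c + q)) (sym j≡1+i) ⟩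
  padded c v (c + toℕ j)       ≡⟨ padded-lookup c v j ⟩
  fin (lookup v j)             ∎
  where open ≡-Reasoning

padded-isStableShape : ∀ {N} c (A : Vec ℤ N) → IsShape A → IsStableShape (padded c A)
padded-isStableShape {N} c A shape =
  prepend-antitone c (embed-interlace A A shape) , c + N , λ _ → padded-≥⇒∞̄ c A

hstrip⇒stableHStrip : ∀ {N} c (A B : Vec ℤ (suc N)) → IsHStrip B A →
  IsStableHStrip (padded c A) (padded (suc c) B)
hstrip⇒stableHStrip {N} c A@(a ∷ _) B (B≤A , A≤B) =
  α⊆β , c , suc (c + N) ,
  ((a , prepend-head c _) , λ i i<c (_ , e) → ∞≢fin (trans (sym (prepend-< c _ i<c)) e)) ,
  (βlast-finite , λ i n<i (_ , e) → ∞̄≢fin (trans (sym (padded-≥⇒∞̄ (suc c) B (last≤ n<i))) e)) ,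
  (λ i 1+i≡c → prepend-< c _ (≤-reflexive 1+i≡c)) ,
  βc≡∞ ,
  subst₂ _<ᴱ_ (sym (prepend-head c _)) (sym βc≡∞) fin<∞ ,
  (λ p _ _ → prepend-mono c (embed-mono B A B≤A) p) ,
  (λ p _ _ → α⊆β p) ,
  subst₂ _<ᴱ_ (sym αn≡∞̄) (sym (proj₂ βlast-finite)) ∞̄<fin ,
  αn≡∞̄ ,
  padded-≥⇒∞̄ (suc c) B (s≤s (≤-reflexive (+-suc c N)))
  where
  ∞≢fin : ∀ {x} → ∞ ≢ fin x
  ∞≢fin ()
  ∞̄≢fin : ∀ {x} → ∞̄ ≢ fin x
  ∞̄≢fin ()
  last≤ : ∀ {i} → suc (c + N) < i → suc c + suc N ≤ i
  last≤ n<i = ≤-trans (s≤s (≤-reflexive (+-suc c N))) n<i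
  α⊆β : padded c A ⊆ˢ padded (suc c) B
  α⊆β = prepend-⊆-suc c λ { zero → ≤∞ ; (suc p) → embed-interlace A B A≤B p }
  βlast-finite : IsFinite (padded (suc c) B (suc (c + N)))
  βlast-finite = let x , e = embed-last-finite B in x , trans (prepend-+ c (embed B) N) e
  βc≡∞ : padded (suc c) B c ≡ ∞
  βc≡∞ = prepend-< (suc c) _ ≤-refl
  αn≡∞̄ : padded c A (suc (c + N)) ≡ ∞̄
  αn≡∞̄ = padded-≥⇒∞̄ c A (≤-reflexive (+-suc c N))

opposite-inject₁ : ∀ {k} (i : Fin k) → opposite (inject₁ i) ≡ fsuc (opposite i)
opposite-inject₁ {suc k} zero     = refl
opposite-inject₁ {suc k} (fsuc i) = cong inject₁ (opposite-inject₁ i)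

opposite-fromℕ : ∀ k → opposite (fromℕ k) ≡ zero
opposite-fromℕ zero    = refl
opposite-fromℕ (suc k) = cong inject₁ (opposite-fromℕ k)

toℕ+toℕ-opposite : ∀ {k} (j : Fin (suc k)) → toℕ j + toℕ (opposite j) ≡ k
toℕ+toℕ-opposite {k}     zero     = toℕ-fromℕ k
toℕ+toℕ-opposite {suc k} (fsuc j) =
  cong suc (trans (cong (toℕ j +_) (toℕ-inject₁ (opposite j))) (toℕ+toℕ-opposite j))

complement-complement : ∀ k (S : StableChain k) → ShiftEq (complement (complement S)) S
complement-complement k S = 0 , k , λ j i →
  trans (prepend-prepend (toℕ j) (toℕ (opposite j)) _ i)
        (cong₂ (λ c j′ → prepend c (S j′) i) (toℕ+toℕ-opposite j) (opposite-involutive j))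

complement-tableau : ∀ k N (T : Fin (suc k) → Vec ℤ (suc N)) → IsTableau k (suc N) T →
  IsStableTableau k (complement (embedT T))
complement-tableau k N T (shapes , strips) =
  (λ j → padded-isStableShape (toℕ j) (T (opposite j)) (shapes (opposite j))) ,
  λ i → subst₂ IsStableHStrip
          (cong₂ (λ c j → padded c (T j)) (sym (toℕ-inject₁ i)) (sym (opposite-inject₁ i)))
          refl
          (hstrip⇒stableHStrip (toℕ i) (T (fsuc (opposite i))) (T (inject₁ (opposite i)))
                               (strips (opposite i)))

antitone-∞̄ : ∀ {s} → Antitone s → s 0 ≡ ∞̄ → ∀ i → s i ≡ ∞̄
antitone-∞̄         anti s0≡∞̄ zero    = s0≡∞̄
antitone-∞̄ {s = s} anti s0≡∞̄ (suc i) = ≤∞̄⇒≡∞̄ (subst (s (suc i) ≤ᴱ_) (antitone-∞̄ anti s0≡∞̄ i) (anti i))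

antitone⇒padded : ∀ L {s} → Antitone s → (∀ i → L ≤ i → s i ≡ ∞̄) →
  Σ ℕ λ a → Σ ℕ λ M → Σ (Vec ℤ M) λ v → s ≗ˢ padded a v
antitone⇒padded zero    anti ∞̄-from-L = 0 , 0 , [] , λ i → ∞̄-from-L i z≤n
antitone⇒padded (suc L) {s} anti ∞̄-from-L
  with s 0 in s0≡ | antitone⇒padded L (anti ∘ suc) (λ i L≤i → ∞̄-from-L (suc i) (s≤s L≤i))
... | ∞     | a , M , v , tail≗ = suc a , M , v , λ { zero → s0≡ ; (suc i) → tail≗ i }
... | fin x | zero , M , v , tail≗ = 0 , suc M , x ∷ v , λ { zero → s0≡ ; (suc i) → tail≗ i }
... | fin x | suc a , _ , _ , tail≗ = ⊥-elim (∞≰fin (subst₂ _≤ᴱ_ (tail≗ 0) s0≡ (anti 0)))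
... | ∞̄     | _ = 0 , 0 , [] , antitone-∞̄ anti s0≡

stableShape⇒padded : ∀ {s} → IsStableShape s → Σ ℕ λ a → Σ ℕ λ M → Σ (Vec ℤ M) λ v → s ≗ˢ padded a v
stableShape⇒padded (anti , L , ∞̄-from-L) = antitone⇒padded L anti ∞̄-from-L

antitone-resp : ∀ {s t} → s ≗ˢ t → Antitone s → Antitone t
antitone-resp s≗t anti i = subst₂ _≤ᴱ_ (s≗t (suc i)) (s≗t i) (anti i)

stableHStrip-resp : ∀ {α α′ β β′} → α ≗ˢ α′ → β ≗ˢ β′ → IsStableHStrip α β → IsStableHStrip α′ β′
stableHStrip-resp α≗ β≗
  (α⊆β , m , n , (αm-fin , α<m-inf) , (βn-fin , β>n-inf) , α∞ , β∞ , α<β , βα , αβ , α<β′ , α∞̄ , β∞̄) =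
  (λ i → subst₂ _≤ᴱ_ (α≗ i) (β≗ i) (α⊆β i)) , m , n ,
  (subst IsFinite (α≗ m) αm-fin , λ i i<m → α<m-inf i i<m ∘ subst IsFinite (sym (α≗ i))) ,
  (subst IsFinite (β≗ n) βn-fin , λ i n<i → β>n-inf i n<i ∘ subst IsFinite (sym (β≗ i))) ,
  (λ i e → trans (sym (α≗ i)) (α∞ i e)) ,
  trans (sym (β≗ m)) β∞ ,
  subst₂ _<ᴱ_ (α≗ m) (β≗ m) α<β ,
  (λ i m≤i i<n → subst₂ _≤ᴱ_ (β≗ (suc i)) (α≗ i) (βα i m≤i i<n)) ,
  (λ i m<i i<n → subst₂ _≤ᴱ_ (α≗ i) (β≗ i) (αβ i m<i i<n)) ,
  subst₂ _<ᴱ_ (α≗ n) (β≗ n) α<β′ ,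
  trans (sym (α≗ n)) α∞̄ ,
  trans (sym (β≗ (suc n))) β∞̄

firstFinite-padded : ∀ {N} a (v : Vec ℤ N) {m} → FirstFinite (padded a v) m →
  (∀ i → suc i ≡ m → padded a v i ≡ ∞) → m ≡ a
firstFinite-padded a v {m} (αm-fin , _) α∞ =
  ≤-antisym (m≤a m α∞) (proj₁ (padded-finite⇒∈ a v m αm-fin))
  where
  m≤a : ∀ m → (∀ i → suc i ≡ m → padded a v i ≡ ∞) → m ≤ a
  m≤a zero    _  = z≤n
  m≤a (suc i) α∞ = padded-∞⇒< a v i (α∞ i refl)

stableHStrip-padded : ∀ {N M} a b (v : Vec ℤ N) (w : Vec ℤ M) →
  IsStableHStrip (padded a v) (padded b w) →
  b ≡ suc a × M ≡ N × (∀ i → a ≤ i → i < a + N → padded b w (suc i) ≤ᴱ padded a v i)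
stableHStrip-padded {N} {M} a b v w
  (_ , m , n , first@(αm-fin , _) , (βn-fin , _) , α∞ , β∞ , _ , interlace , _ , _ , α∞̄ , β∞̄) =
  b≡1+a , M≡N , interlace′
  where
  m≡a : m ≡ a
  m≡a = firstFinite-padded a v first α∞
  a+N≤n : a + N ≤ n
  a+N≤n = padded-∞̄⇒≥ a v n α∞̄
  n<b+M : n < b + M
  n<b+M = proj₂ (padded-finite⇒∈ b w n βn-fin)
  b+M≤1+n : b + M ≤ suc n
  b+M≤1+n = padded-∞̄⇒≥ b w (suc n) β∞̄
  interlace′ : ∀ i → a ≤ i → i < a + N → padded b w (suc i) ≤ᴱ padded a v i
  interlace′ i a≤i i<a+N = interlace i (subst (_≤ i) (sym m≡a) a≤i) (<-≤-trans i<a+N a+N≤n)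
  -- β_{a+1} ≤ α_a, which is finite, so β has at most a + 1 leading ∞'s.
  b≤1+a : b ≤ suc a
  b≤1+a = ≮⇒≥ λ 1+a<b →
    let x , αa≡x = subst (IsFinite ∘ padded a v) m≡a αm-fin
        a<a+N   = proj₂ (padded-finite⇒∈ a v a (x , αa≡x))
    in ∞≰fin (subst₂ _≤ᴱ_ (prepend-< b _ 1+a<b) αa≡x (interlace′ a ≤-refl a<a+N))
  b≡1+a : b ≡ suc a
  b≡1+a = ≤-antisym b≤1+a (subst (_< b) m≡a (padded-∞⇒< b w m β∞))
  -- Beyond a + N, α is ∞̄ and hence so is the interlaced β, which ends at n.
  n≤a+N : n ≤ a + N
  n≤a+N = ≮⇒≥ λ a+N<n →
    let βa+N+1≡∞̄ = ≤∞̄⇒≡∞̄ (subst (_ ≤ᴱ_) (padded-≥⇒∞̄ a v ≤-refl)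
                       (interlace (a + N) (subst (_≤ a + N) (sym m≡a) (m≤m+n a N)) a+N<n))
    in <⇒≱ a+N<n (s≤s⁻¹ (≤-trans n<b+M (padded-∞̄⇒≥ b w _ βa+N+1≡∞̄)))
  M≡N : M ≡ N
  M≡N = +-cancelˡ-≡ b M N (begin
    b + M       ≡⟨ ≤-antisym b+M≤1+n n<b+M ⟩
    suc n       ≡⟨ cong suc (≤-antisym n≤a+N a+N≤n) ⟩
    suc a + N   ≡⟨ cong (_+ N) (sym b≡1+a) ⟩
    b + N       ∎)
    where open ≡-Reasoning

stableHStrip⇒hstrip : ∀ {N} a (v w : Vec ℤ N) →
  IsStableHStrip (padded a v) (padded (suc a) w) → IsHStrip w v
stableHStrip⇒hstrip {N} a v w strip@(α⊆β , _) = w≤v , v≤w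
  where
  interlace : ∀ i → a ≤ i → i < a + N → padded a w i ≤ᴱ padded a v i
  interlace = proj₂ (proj₂ (stableHStrip-padded a (suc a) v w strip))
  w≤v : ∀ f → lookup w f ℤ.≤ lookup v f
  w≤v f = fin≤fin⁻¹ (subst₂ _≤ᴱ_ (padded-lookup a w f) (padded-lookup a v f)
            (interlace (a + toℕ f) (m≤m+n a (toℕ f)) (+-monoʳ-< a (toℕ<n f))))
  v≤w : ∀ i j → toℕ j ≡ suc (toℕ i) → lookup v j ℤ.≤ lookup w i
  v≤w i j j≡1+i = fin≤fin⁻¹ (subst₂ _≤ᴱ_ (padded-lookup-next a v j≡1+i) (padded-lookup a w i)
            (α⊆β (suc (a + toℕ i))))

padded-antitone⇒isShape : ∀ {N} c (v : Vec ℤ N) → Antitone (padded c v) → IsShape v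
padded-antitone⇒isShape c v anti i j j≡1+i =
  fin≤fin⁻¹ (subst₂ _≤ᴱ_ (padded-lookup-next c v j≡1+i) (padded-lookup c v i) (anti (c + toℕ i)))

stableTableau⇒padded : ∀ k (S : StableChain k) → IsStableTableau k S →
  Σ ℕ λ a → Σ ℕ λ N → Σ (Fin (suc k) → Vec ℤ N) λ V → ∀ j → S j ≗ˢ padded (toℕ j + a) (V j)
stableTableau⇒padded k S (shapes , strips) with stableShape⇒padded (shapes zero)
... | a , N , v₀ , S₀≗ = a , N , proj₁ ∘ padding , proj₂ ∘ padding
  where
  Padded : Fin (suc k) → Set
  Padded j = Σ (Vec ℤ N) λ v → S j ≗ˢ padded (toℕ j + a) v
  next : ∀ i → Padded (inject₁ i) → Padded (fsuc i)
  next i (v , Sᵢ≗) with stableShape⇒padded (shapes (fsuc i))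
  ... | b , M , w , Sᵢ₊₁≗
    with stableHStrip-padded (toℕ (inject₁ i) + a) b v w (stableHStrip-resp Sᵢ≗ Sᵢ₊₁≗ (strips i))
  ... | refl , refl , _ = w , λ p → trans (Sᵢ₊₁≗ p) (cong (λ c → padded (suc (c + a)) w p) (toℕ-inject₁ i))
  padding : ∀ j → Padded j
  padding = <-weakInduction Padded (v₀ , S₀≗) next

complement-stableTableau : ∀ k (S : StableChain k) → IsStableTableau k S →
  Σ ℕ λ c → Σ ℕ λ N → Σ (Fin (suc k) → Vec ℤ N) λ T →
    IsTableau k N T × (∀ j → complement S j ≗ˢ prepend c (embed (T j)))
complement-stableTableau k S tableau@(shapes , strips) with stableTableau⇒padded k S tableau
... | a , N , V , S≗ = k + a , N , T , (T-shape , T-strip) , complement≗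
  where
  T : Fin (suc k) → Vec ℤ N
  T = V ∘ opposite
  T-shape : ∀ j → IsShape (T j)
  T-shape j = padded-antitone⇒isShape (toℕ (opposite j) + a) (T j)
                (antitone-resp (S≗ (opposite j)) (proj₁ (shapes (opposite j))))
  T-strip : ∀ i → IsHStrip (T (inject₁ i)) (T (fsuc i))
  T-strip i = subst (λ j → IsHStrip (V j) (T (fsuc i))) (sym (opposite-inject₁ i))
    (stableHStrip⇒hstrip (toℕ o + a) (V (inject₁ o)) (V (fsuc o))
      (stableHStrip-resp Sₒ≗ (S≗ (fsuc o)) (strips o)))
    where
    o = opposite i
    Sₒ≗ : S (inject₁ o) ≗ˢ padded (toℕ o + a) (V (inject₁ o))
    Sₒ≗ p = trans (S≗ (inject₁ o) p) (cong (λ c → padded (c + a) (V (inject₁ o)) p) (toℕ-inject₁ o))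
  complement≗ : ∀ j → complement S j ≗ˢ padded (k + a) (T j)
  complement≗ j p = begin
    prepend (toℕ j) (S (opposite j)) p                     ≡⟨ prepend-cong (toℕ j) (S≗ (opposite j)) p ⟩
    prepend (toℕ j) (padded (toℕ (opposite j) + a) (T j)) p ≡⟨ prepend-prepend (toℕ j) _ (embed (T j)) p ⟩
    padded (toℕ j + (toℕ (opposite j) + a)) (T j) p        ≡⟨ cong (λ c → padded c (T j) p) offset ⟩
    padded (k + a) (T j) p                                 ∎
    where
    open ≡-Reasoning
    offset : toℕ j + (toℕ (opposite j) + a) ≡ k + a
    offset = trans (sym (+-assoc (toℕ j) _ a)) (cong (_+ a) (toℕ+toℕ-opposite j))

theorem5p4 :
    ((k N : ℕ) (T : Fin (suc k) → Vec ℤ (suc N)) → IsTableau k (suc N) T →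
      IsStableTableau k (complement (embedT T))
      × (complement (embedT T) zero ≗ˢ embed (T (fromℕ k)))
      × (complement (embedT T) (fromℕ k) ≗ˢ prepend k (embed (T zero)))
      × ShiftEq (complement (complement (embedT T))) (embedT T))
    ×
    ((k : ℕ) (S : StableChain k) → IsStableTableau k S →
      (Σ ℕ λ c → Σ ℕ λ N → Σ (Fin (suc k) → Vec ℤ N) λ T →
        IsTableau k N T × ((j : Fin (suc k)) → complement S j ≗ˢ prepend c (embed (T j))))
      × ShiftEq (complement (complement S)) S)
theorem5p4 =
  (λ k N T tableau →
    complement-tableau k N T tableau ,
    (λ _ → refl) ,
    (λ p → cong₂ (λ c j → padded c (T j) p) (toℕ-fromℕ k) (opposite-fromℕ k)) ,
    complement-complement k (embedT T)) ,
  (λ k S tableau → complement-stableTableau k S tableau , complement-complement k S)
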